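{- Let $n,k,s$ be positive integers with $k<n$ and $s<n$, and let $t$ be a positive integer. There exists a $t$-admissible $(n,k,s)$-configuration if and only if $nt\le ks$.
   Context: An $(n,k,s)$-configuration (for positive integers $k,s<n$) consists of a circle $C$ with $n$ spots, $k$ of which are filled with the letter $A$ and the remaining $n-k$ with the letter $B$, together with the collection $\Sigma$ of all subsets of $s$ cyclically consecutive spots of the circle. The configuration is called $t$-admissible if every element of $\Sigma$ (i.e. every set of $s$ cyclically consecutive spots) contains at least $t$ letters $A$. -}

module Defs where

open import Data.Nat using (ℕ; zero; suc; _+_; _*_; _≤_; _<_; NonZero)
open import Data.Nat.DivMod using (_%_; m%n<n)
open import Data.Fin using (Fin; toℕ; fromℕ<)
open import Data.Bool using (Bool; true; false)
open import Data.Product using (Σ)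
open import Relation.Binary.PropositionalEquality using (_≡_)

-- Indicator of the letter A (A is encoded as true, B as false).
isA : Bool → ℕ
isA true  = 1
isA false = 0

sumTo : ℕ → (ℕ → ℕ) → ℕ
sumTo zero    f = 0
sumTo (suc m) f = sumTo m f + f m

-- A filling of the n spots of the circle C (spots 0..n-1 in cyclic order).
Filling : ℕ → Set
Filling n = Fin n → Bool

spot : (n : ℕ) .{{_ : NonZero n}} → ℕ → Fin n
spot n m = fromℕ< (m%n<n m n)

countA : (n : ℕ) .{{_ : NonZero n}} → Filling n → ℕ
countA n c = sumTo n (λ m → isA (c (spot n m)))

-- Number of letters A in the element of Σ starting at spot i,
-- i.e. in the s cyclically consecutive spots i, i+1, ..., i+s-1 (mod n).
windowA : (n : ℕ) .{{_ : NonZero n}} → ℕ → Filling n → Fin n → ℕ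
windowA n s c i = sumTo s (λ j → isA (c (spot n (toℕ i + j))))

-- An (n,k,s)-configuration: the n spots filled with exactly k letters A
-- (the rest B); Σ, the family of all s-windows, is determined by n and s.
Configuration : (n : ℕ) .{{_ : NonZero n}} → ℕ → Set
Configuration n k = Σ (Filling n) (λ c → countA n c ≡ k)

Admissible : (n : ℕ) .{{_ : NonZero n}} → (s t : ℕ) → Filling n → Set
Admissible n s t c = (i : Fin n) → t ≤ windowA n s c i

{-# OPTIONS --safe #-}
module Submission where

-- Double counting gives necessity: each spot lies in exactly s of the n windows, so
-- the window counts sum to s k, and n windows with at least t letters A each force
-- n t ≤ k s.  For sufficiency place the letters A as evenly as possible (a Sturmian,
-- or Beatty, word): spot m gets an A iff ⌊(m+1)k/n⌋ > ⌊mk/n⌋.  The window starting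
-- at i then contains exactly ⌊(i+s)k/n⌋ − ⌊ik/n⌋ ≥ ⌊sk/n⌋ ≥ t letters A.

open import Defs
open import Data.Nat using (ℕ; zero; suc; _+_; _*_; _∸_; _/_; _%_; _≤_; _<_; z≤n; s≤s; NonZero)
open import Data.Nat.Properties
open import Data.Nat.DivMod
open import Data.Nat.Divisibility using (∣-refl; m∣m*n)
open import Data.Fin using (toℕ; fromℕ<)
open import Data.Fin.Properties using (toℕ-fromℕ<; fromℕ<-cong)
open import Data.Bool using (Bool; true; false)
open import Data.Product using (Σ; proj₁; _,_)
open import Function.Bundles using (_⇔_; mk⇔)
open import Relation.Binary.PropositionalEquality
open import Algebra.Properties.CommutativeSemigroup +-commutativeSemigroup using (interchange)

sumTo-cong : ∀ m {f g : ℕ → ℕ} → (∀ i → f i ≡ g i) → sumTo m f ≡ sumTo m g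
sumTo-cong zero    _   = refl
sumTo-cong (suc m) f≗g = cong₂ _+_ (sumTo-cong m f≗g) (f≗g m)

sumTo-distrib-+ : ∀ m (f g : ℕ → ℕ) →
                  sumTo m (λ i → f i + g i) ≡ sumTo m f + sumTo m g
sumTo-distrib-+ zero    f g = refl
sumTo-distrib-+ (suc m) f g =
  trans (cong (_+ (f m + g m)) (sumTo-distrib-+ m f g))
        (interchange (sumTo m f) (sumTo m g) (f m) (g m))

sumTo-const : ∀ m c → sumTo m (λ _ → c) ≡ m * c
sumTo-const zero    c = refl
sumTo-const (suc m) c = trans (cong (_+ c) (sumTo-const m c)) (+-comm (m * c) c)

sumTo-swap : ∀ a b (F : ℕ → ℕ → ℕ) →
             sumTo a (λ i → sumTo b (F i)) ≡ sumTo b (λ j → sumTo a (λ i → F i j))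
sumTo-swap a zero    F = trans (sumTo-const a 0) (*-zeroʳ a)
sumTo-swap a (suc b) F =
  trans (sumTo-distrib-+ a (λ i → sumTo b (F i)) (λ i → F i b))
        (cong (_+ sumTo a (λ i → F i b)) (sumTo-swap a b F))

sumTo-head : ∀ m (h : ℕ → ℕ) → sumTo (suc m) h ≡ h 0 + sumTo m (λ i → h (suc i))
sumTo-head zero    h = sym (+-identityʳ (h 0))
sumTo-head (suc m) h =
  trans (cong (_+ h (suc m)) (sumTo-head m h))
        (+-assoc (h 0) (sumTo m (λ i → h (suc i))) (h (suc m)))

*≤sumTo : ∀ m t (h : ℕ → ℕ) → (∀ i → i < m → t ≤ h i) → m * t ≤ sumTo m h
*≤sumTo zero    t h t≤h = z≤n
*≤sumTo (suc m) t h t≤h =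
  subst (_≤ sumTo m h + h m) (+-comm (m * t) t)
        (+-mono-≤ (*≤sumTo m t h (λ i i<m → t≤h i (m<n⇒m<1+n i<m))) (t≤h m ≤-refl))

sumTo-telescope : ∀ {f : ℕ → ℕ} → (∀ m → f m ≤ f (suc m)) →
                  ∀ i s → f i + sumTo s (λ j → f (suc (i + j)) ∸ f (i + j)) ≡ f (i + s)
sumTo-telescope {f} _ i zero = trans (+-identityʳ (f i)) (cong f (sym (+-identityʳ i)))
sumTo-telescope {f} f-mono i (suc s) = begin
  f i + (S + d)       ≡⟨ +-assoc (f i) S d ⟨
  f i + S + d         ≡⟨ cong (_+ d) (sumTo-telescope f-mono i s) ⟩
  f (i + s) + d       ≡⟨ m+[n∸m]≡n (f-mono (i + s)) ⟩
  f (suc (i + s))     ≡⟨ cong f (+-suc i s) ⟨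
  f (i + suc s)       ∎
  where
  open ≡-Reasoning
  S = sumTo s (λ j → f (suc (i + j)) ∸ f (i + j))
  d = f (suc (i + s)) ∸ f (i + s)

Periodic : ∀ {a} {A : Set a} → ℕ → (ℕ → A) → Set a
Periodic n g = ∀ m → g (n + m) ≡ g m

periodic-% : ∀ {a} {A : Set a} {n} .{{_ : NonZero n}} {g : ℕ → A} →
             Periodic n g → ∀ m → g (m % n) ≡ g m
periodic-% {n = n} {g} per m = begin
  g (m % n)               ≡⟨ periodic-* (m / n) (m % n) ⟨
  g (m / n * n + m % n)   ≡⟨ cong g (trans (m≡m%n+[m/n]*n m n) (+-comm (m % n) (m / n * n))) ⟨
  g m                     ∎
  where
  open ≡-Reasoning
  periodic-* : ∀ q r → g (q * n + r) ≡ g r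
  periodic-* zero    r = refl
  periodic-* (suc q) r = trans (cong g (+-assoc n (q * n) r))
                               (trans (per (q * n + r)) (periodic-* q r))

sumTo-rotate : ∀ {n} {g : ℕ → ℕ} → Periodic n g →
               ∀ j → sumTo n (λ i → g (i + j)) ≡ sumTo n g
sumTo-rotate {n} {g} per zero = sumTo-cong n (λ i → cong g (+-identityʳ i))
sumTo-rotate {n} {g} per (suc j) = begin
  sumTo n (λ i → g (i + suc j)) ≡⟨ sumTo-cong n (λ i → cong g (+-suc i j)) ⟩
  sumTo n (λ i → h (suc i))     ≡⟨ +-cancelˡ-≡ (g j) _ _ rotate-once ⟩
  sumTo n h                     ≡⟨ sumTo-rotate per j ⟩
  sumTo n g                     ∎
  where
  open ≡-Reasoning
  h : ℕ → ℕ
  h i = g (i + j)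
  rotate-once : g j + sumTo n (λ i → h (suc i)) ≡ g j + sumTo n h
  rotate-once = begin
    g j + sumTo n (λ i → h (suc i)) ≡⟨ sumTo-head n h ⟨
    sumTo n h + g (n + j)           ≡⟨ cong (sumTo n h +_) (per j) ⟩
    sumTo n h + g j                 ≡⟨ +-comm (sumTo n h) (g j) ⟩
    g j + sumTo n h                 ∎

m*n≤o⇒m≤o/n : ∀ {m n o} .{{_ : NonZero n}} → m * n ≤ o → m ≤ o / n
m*n≤o⇒m≤o/n {m} {n} m*n≤o = ≤-trans (≤-reflexive (sym (m*n/n≡m m n))) (/-monoˡ-≤ n m*n≤o)

m/o+n/o≤[m+n]/o : ∀ m n o .{{_ : NonZero o}} → m / o + n / o ≤ (m + n) / o
m/o+n/o≤[m+n]/o m n o = m*n≤o⇒m≤o/n (begin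
  (m / o + n / o) * o     ≡⟨ *-distribʳ-+ o (m / o) (n / o) ⟩
  m / o * o + n / o * o   ≤⟨ +-mono-≤ (m/n*n≤m m o) (m/n*n≤m n o) ⟩
  m + n                   ∎)
  where open ≤-Reasoning

indicator : (n : ℕ) .{{_ : NonZero n}} → Filling n → ℕ → ℕ
indicator n c m = isA (c (spot n m))

spot-periodic : ∀ n .{{_ : NonZero n}} → Periodic n (spot n)
spot-periodic n m = fromℕ<-cong _ _ (%-remove-+ˡ m (∣-refl {n})) _ _

sumTo-windowA : ∀ n s .{{_ : NonZero n}} (c : Filling n) →
                sumTo n (λ i → sumTo s (λ j → indicator n c (i + j))) ≡ s * countA n c
sumTo-windowA n s c = begin
  sumTo n (λ i → sumTo s (λ j → indicator n c (i + j))) ≡⟨ sumTo-swap n s _ ⟩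
  sumTo s (λ j → sumTo n (λ i → indicator n c (i + j))) ≡⟨ sumTo-cong s (sumTo-rotate indicator-periodic) ⟩
  sumTo s (λ _ → countA n c)                            ≡⟨ sumTo-const s (countA n c) ⟩
  s * countA n c                                        ∎
  where
  open ≡-Reasoning
  indicator-periodic : Periodic n (indicator n c)
  indicator-periodic m = cong (λ x → isA (c x)) (spot-periodic n m)

admissible⇒n*t≤s*countA : ∀ n s t .{{_ : NonZero n}} (c : Filling n) →
                          Admissible n s t c → n * t ≤ s * countA n c
admissible⇒n*t≤s*countA n s t c adm =
  subst (n * t ≤_) (sumTo-windowA n s c) (*≤sumTo n t _ t≤window)
  where
  t≤window : ∀ i → i < n → t ≤ sumTo s (λ j → indicator n c (i + j))
  t≤window i i<n = subst (λ x → t ≤ sumTo s (λ j → indicator n c (x + j)))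
                         (toℕ-fromℕ< i<n) (adm (fromℕ< i<n))

letter : ℕ → Bool
letter zero    = false
letter (suc _) = true

isA-letter : ∀ {x} → x ≤ 1 → isA (letter x) ≡ x
isA-letter {zero}        _ = refl
isA-letter {suc zero}    _ = refl
isA-letter {suc (suc x)} (s≤s ())

fillingOf : (n : ℕ) → (ℕ → ℕ) → Filling n
fillingOf n a i = letter (a (toℕ i))

indicator-fillingOf : ∀ {n} .{{_ : NonZero n}} {a : ℕ → ℕ} →
                      (∀ m → a m ≤ 1) → Periodic n a →
                      ∀ m → indicator n (fillingOf n a) m ≡ a m
indicator-fillingOf {n} {a = a} a≤1 per m =
  trans (isA-letter (a≤1 _))
        (trans (cong a (toℕ-fromℕ< (m%n<n m n))) (periodic-% per m))

module Sturmian {n k : ℕ} .{{_ : NonZero n}} (k≤n : k ≤ n) where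

  beatty : ℕ → ℕ
  beatty m = m * k / n

  gap : ℕ → ℕ
  gap m = beatty (suc m) ∸ beatty m

  beatty-mono : ∀ m → beatty m ≤ beatty (suc m)
  beatty-mono m = /-monoˡ-≤ n (m≤n+m (m * k) k)

  beatty-suc≤ : ∀ m → beatty (suc m) ≤ beatty m + 1
  beatty-suc≤ m = begin
    (k + m * k) / n     ≤⟨ /-monoˡ-≤ n (+-monoˡ-≤ (m * k) k≤n) ⟩
    (n + m * k) / n     ≡⟨ +-distrib-/-∣ˡ (m * k) (∣-refl {n}) ⟩
    n / n + beatty m    ≡⟨ cong (_+ beatty m) (n/n≡1 n) ⟩
    1 + beatty m        ≡⟨ +-comm 1 (beatty m) ⟩
    beatty m + 1        ∎
    where open ≤-Reasoning

  beatty-shift : ∀ m → beatty (n + m) ≡ k + beatty m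
  beatty-shift m = begin
    (n + m) * k / n           ≡⟨ cong (_/ n) (*-distribʳ-+ k n m) ⟩
    (n * k + m * k) / n       ≡⟨ +-distrib-/-∣ˡ (m * k) (m∣m*n k) ⟩
    n * k / n + beatty m      ≡⟨ cong (λ x → x / n + beatty m) (*-comm n k) ⟩
    k * n / n + beatty m      ≡⟨ cong (_+ beatty m) (m*n/n≡m k n) ⟩
    k + beatty m              ∎
    where open ≡-Reasoning

  gap≤1 : ∀ m → gap m ≤ 1
  gap≤1 m = m≤n+o⇒m∸n≤o (beatty (suc m)) (beatty m) (beatty-suc≤ m)

  gap-periodic : Periodic n gap
  gap-periodic m = begin
    beatty (suc (n + m)) ∸ beatty (n + m)
      ≡⟨ cong₂ _∸_ (trans (cong beatty (sym (+-suc n m))) (beatty-shift (suc m))) (beatty-shift m) ⟩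
    (k + beatty (suc m)) ∸ (k + beatty m)
      ≡⟨ [m+n]∸[m+o]≡n∸o k (beatty (suc m)) (beatty m) ⟩
    gap m ∎
    where open ≡-Reasoning

  filling : Filling n
  filling = fillingOf n gap

  beatty+window : ∀ i s → beatty i + sumTo s (λ j → indicator n filling (i + j)) ≡ beatty (i + s)
  beatty+window i s =
    trans (cong (beatty i +_) (sumTo-cong s (λ j → indicator-fillingOf gap≤1 gap-periodic (i + j))))
          (sumTo-telescope beatty-mono i s)

  countA-filling : countA n filling ≡ k
  countA-filling = begin
    countA n filling                ≡⟨ cong (_+ countA n filling) (0/n≡0 n) ⟨
    beatty 0 + countA n filling     ≡⟨ beatty+window 0 n ⟩
    n * k / n                       ≡⟨ cong (_/ n) (*-comm n k) ⟩
    k * n / n                       ≡⟨ m*n/n≡m k n ⟩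
    k                               ∎
    where open ≡-Reasoning

  filling-admissible : ∀ {s t} → n * t ≤ k * s → Admissible n s t filling
  filling-admissible {s} {t} nt≤ks i =
    +-cancelˡ-≤ (beatty (toℕ i)) t _
      (subst (beatty (toℕ i) + t ≤_) (sym (beatty+window (toℕ i) s)) (beatty+t≤ (toℕ i)))
    where
    open ≤-Reasoning
    beatty+t≤ : ∀ i → beatty i + t ≤ beatty (i + s)
    beatty+t≤ i = begin
      beatty i + t               ≤⟨ +-monoʳ-≤ (beatty i) (m*n≤o⇒m≤o/n (subst₂ _≤_ (*-comm n t) (*-comm k s) nt≤ks)) ⟩
      beatty i + s * k / n       ≤⟨ m/o+n/o≤[m+n]/o (i * k) (s * k) n ⟩
      (i * k + s * k) / n        ≡⟨ cong (_/ n) (*-distribʳ-+ k i s) ⟨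
      beatty (i + s)             ∎

proposition2p2 : (n k s t : ℕ) .{{_ : NonZero n}} →
    1 ≤ k → k < n → 1 ≤ s → s < n → 1 ≤ t →
    (Σ (Configuration n k) (λ cfg → Admissible n s t (proj₁ cfg))) ⇔ (n * t ≤ k * s)
proposition2p2 n k s t _ k<n _ _ _ = mk⇔
  (λ ((c , countA≡k) , adm) →
     subst (n * t ≤_) (trans (cong (s *_) countA≡k) (*-comm s k))
           (admissible⇒n*t≤s*countA n s t c adm))
  (λ nt≤ks → (filling , countA-filling) , filling-admissible nt≤ks)
  where open Sturmian (<⇒≤ k<n)
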